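{- Let $G$ be a finite simple connected graph with vertex degrees $d_1,\dots,d_n$, $m$ edges and edge set $E$. Then $$\sum_{i=1}^n d_i^5 + 2\sum_{(i,j)\in E} d_i^2 d_j^2 \ge \frac{F(G)^2}{m},$$ where $F(G)=\sum_{i=1}^n d_i^3$, with equality if $G$ is regular or semiregular.
   Context: All graphs are finite, simple and connected with $n\ge 3$ vertices; $d_i$ is the degree of vertex $v_i$ and $(i,j)$ denotes the edge joining $v_i$ and $v_j$. A graph is regular if all vertices have the same degree. A connected graph is bidegreed with degrees $\Delta>\delta$ if every vertex has degree $\Delta$ or $\delta$ and both occur; a semiregular graph is a connected bidegreed bipartite graph in which all vertices in the same part of the bipartition have the same degree. -}

module Defs where

open import Data.Nat using (ℕ; zero; suc; _+_; _*_; _^_; _≤_; _<_)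
open import Data.Fin using (Fin; toℕ)
import Data.Fin as F
open import Data.Bool using (Bool; true; false; if_then_else_)
open import Data.Product using (Σ; _×_; _,_; ∃; ∃-syntax)
open import Relation.Binary.PropositionalEquality using (_≡_; _≢_)
open import Relation.Nullary.Decidable using (⌊_⌋)
open import Data.Nat using (_<?_)

sumFin : {n : ℕ} → (Fin n → ℕ) → ℕ
sumFin {zero}  f = 0
sumFin {suc n} f = f F.zero + sumFin (λ i → f (F.suc i))

record Graph (n : ℕ) : Set where
  field
    adj       : Fin n → Fin n → Bool
    adj-sym   : ∀ i j → adj i j ≡ adj j i
    adj-irrfl : ∀ i → adj i i ≡ false
open Graph public

deg : {n : ℕ} → Graph n → Fin n → ℕ
deg G i = sumFin (λ j → if adj G i j then 1 else 0)

edgeSum : {n : ℕ} → Graph n → (Fin n → Fin n → ℕ) → ℕ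
edgeSum G f =
  sumFin (λ i → sumFin (λ j →
    if ⌊ toℕ i <? toℕ j ⌋ then (if adj G i j then f i j else 0) else 0))

edgeCount : {n : ℕ} → Graph n → ℕ
edgeCount G = edgeSum G (λ _ _ → 1)

data Walk {n : ℕ} (G : Graph n) : Fin n → Fin n → Set where
  here : ∀ {u} → Walk G u u
  step : ∀ {u w v} → adj G u w ≡ true → Walk G w v → Walk G u v

Connected : {n : ℕ} → Graph n → Set
Connected G = ∀ u v → Walk G u v

forgotten : {n : ℕ} → Graph n → ℕ
forgotten G = sumFin (λ i → deg G i ^ 3)

Regular : {n : ℕ} → Graph n → Set
Regular G = ∃[ k ] (∀ i → deg G i ≡ k)

-- Semiregular: connected bidegreed bipartite graph in which all vertices in
-- the same part of the bipartition have the same degree.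
Semiregular : {n : ℕ} → Graph n → Set
Semiregular G =
  Connected G ×
  Σ (_ → Bool) λ c → Σ ℕ λ a → Σ ℕ λ b →
    (a ≢ b) ×
    (∀ i j → adj G i j ≡ true → c i ≢ c j) ×
    (∀ i → c i ≡ true → deg G i ≡ a) ×
    (∀ i → c i ≡ false → deg G i ≡ b) ×
    (∃[ u ] deg G u ≡ a) × (∃[ v ] deg G v ≡ b)

-- Handshaking turns vertex sums into edge sums: Σᵢ dᵢ xᵢ = Σ_{ij∈E} (xᵢ + xⱼ).
-- With xᵢ = dᵢ² and xᵢ = dᵢ⁴ this gives F(G) = Σ_E sᵢⱼ and
-- Σ dᵢ⁵ + 2 Σ_E dᵢ² dⱼ² = Σ_E sᵢⱼ², where sᵢⱼ = dᵢ² + dⱼ².  The inequality is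
-- then Cauchy–Schwarz (Σ_E s)² ≤ m Σ_E s², which is an equality whenever s is
-- constant on the edges, as it is for regular and semiregular graphs.
module Submission where

open import Defs
open import Data.Bool using (Bool; true; false; if_then_else_)
open import Data.Empty using (⊥-elim)
open import Data.Fin using (Fin; toℕ)
import Data.Fin as F
open import Data.Fin.Properties using (toℕ-injective)
open import Data.Nat using (ℕ; zero; suc; _+_; _*_; _^_; _≤_; _<_; _<?_; _≤?_; z≤n)
open import Data.Nat.Properties
open import Algebra.Properties.CommutativeSemigroup *-commutativeSemigroup using (x∙yz≈y∙xz)
open import Algebra.Properties.Semiring.Sum +-*-semiring
  using (sum; sum-cong-≗; ∑-distrib-+; ∑-comm; *-distribˡ-sum; *-distribʳ-sum)
open import Data.Nat.Solver using (module +-*-Solver)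
open import Data.Nat.Tactic.RingSolver using (solve-∀)
open import Data.Product using (_×_; _,_; ∃-syntax)
open import Data.Sum using (_⊎_; inj₁; inj₂; [_,_]′)
open import Relation.Binary.PropositionalEquality
open import Relation.Nullary using (yes; no)
open import Relation.Nullary.Decidable using (⌊_⌋)

am-gm : ∀ p q → 4 * (p * q) ≤ (p + q) * (p + q)
am-gm p q = [ am-gm-≤ , swap-am-gm ]′ (≤-total p q)
  where
  am-gm-≤ : ∀ {p q} → p ≤ q → 4 * (p * q) ≤ (p + q) * (p + q)
  am-gm-≤ {p} p≤q with m≤n⇒∃[o]m+o≡n p≤q
  ... | t , refl = subst (4 * (p * (p + t)) ≤_) (sym (expand p t)) (m≤m+n _ _)
    where
    expand : ∀ p t → (p + (p + t)) * (p + (p + t)) ≡ 4 * (p * (p + t)) + t * t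
    expand = solve-∀
  swap-am-gm : q ≤ p → 4 * (p * q) ≤ (p + q) * (p + q)
  swap-am-gm q≤p =
    subst₂ _≤_ (cong (4 *_) (*-comm q p)) (cong₂ _*_ (+-comm q p) (+-comm q p)) (am-gm-≤ q≤p)

x*x≤p*q⇒2*x≤p+q : ∀ x p q → x * x ≤ p * q → 2 * x ≤ p + q
x*x≤p*q⇒2*x≤p+q x p q x²≤pq with 2 * x ≤? p + q
... | yes 2x≤p+q = 2x≤p+q
... | no 2x≰p+q = ⊥-elim (<⇒≱ [p+q]²<4pq (am-gm p q))
  where
  square-double : ∀ x → (2 * x) * (2 * x) ≡ 4 * (x * x)
  square-double = solve-∀
  [p+q]²<4pq : (p + q) * (p + q) < 4 * (p * q)
  [p+q]²<4pq = begin-strict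
    (p + q) * (p + q)   <⟨ *-mono-< (≰⇒> 2x≰p+q) (≰⇒> 2x≰p+q) ⟩
    (2 * x) * (2 * x)   ≡⟨ square-double x ⟩
    4 * (x * x)         ≤⟨ *-monoʳ-≤ 4 x²≤pq ⟩
    4 * (p * q)         ∎
    where open ≤-Reasoning

square≤product-+ : ∀ {A a C c B b} → A * A ≤ C * B → a * a ≤ c * b →
                   (A + a) * (A + a) ≤ (C + c) * (B + b)
square≤product-+ {A} {a} {C} {c} {B} {b} A²≤CB a²≤cb = begin
  (A + a) * (A + a)                     ≡⟨ expandˡ A a ⟩
  (A * A + a * a) + 2 * (A * a)         ≤⟨ +-mono-≤ (+-mono-≤ A²≤CB a²≤cb) cross ⟩
  (C * B + c * b) + (C * b + c * B)     ≡⟨ expandʳ C B c b ⟨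
  (C + c) * (B + b)                     ∎
  where
  open ≤-Reasoning
  expandˡ : ∀ A a → (A + a) * (A + a) ≡ (A * A + a * a) + 2 * (A * a)
  expandˡ = solve-∀
  expandʳ : ∀ C B c b → (C + c) * (B + b) ≡ (C * B + c * b) + (C * b + c * B)
  expandʳ = solve-∀
  regroupˡ : ∀ A a → (A * a) * (A * a) ≡ (A * A) * (a * a)
  regroupˡ = solve-∀
  regroupʳ : ∀ C B c b → (C * B) * (c * b) ≡ (C * b) * (c * B)
  regroupʳ = solve-∀
  cross : 2 * (A * a) ≤ C * b + c * B
  cross = x*x≤p*q⇒2*x≤p+q (A * a) (C * b) (c * B)
    (subst₂ _≤_ (sym (regroupˡ A a)) (regroupʳ C B c b) (*-mono-≤ A²≤CB a²≤cb))

sumFin≡sum : ∀ {n} (f : Fin n → ℕ) → sumFin f ≡ sum f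
sumFin≡sum {zero}  f = refl
sumFin≡sum {suc n} f = cong (f F.zero +_) (sumFin≡sum (λ i → f (F.suc i)))

sumFin-cong : ∀ {n} {f g : Fin n → ℕ} → (∀ i → f i ≡ g i) → sumFin f ≡ sumFin g
sumFin-cong {f = f} {g} f≗g = begin
  sumFin f   ≡⟨ sumFin≡sum f ⟩
  sum f      ≡⟨ sum-cong-≗ f≗g ⟩
  sum g      ≡⟨ sumFin≡sum g ⟨
  sumFin g   ∎
  where open ≡-Reasoning

sumFin-distrib-+ : ∀ {n} (f g : Fin n → ℕ) → sumFin (λ i → f i + g i) ≡ sumFin f + sumFin g
sumFin-distrib-+ f g
  rewrite sumFin≡sum (λ i → f i + g i) | sumFin≡sum f | sumFin≡sum g = ∑-distrib-+ f g

*-distribˡ-sumFin : ∀ {n} k (f : Fin n → ℕ) → k * sumFin f ≡ sumFin (λ i → k * f i)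
*-distribˡ-sumFin k f rewrite sumFin≡sum f | sumFin≡sum (λ i → k * f i) = *-distribˡ-sum k f

*-distribʳ-sumFin : ∀ {n} k (f : Fin n → ℕ) → sumFin f * k ≡ sumFin (λ i → f i * k)
*-distribʳ-sumFin k f rewrite sumFin≡sum f | sumFin≡sum (λ i → f i * k) = *-distribʳ-sum k f

sumFin-cauchySchwarz : ∀ {n} (a c b : Fin n → ℕ) → (∀ i → a i * a i ≤ c i * b i) →
                       sumFin a * sumFin a ≤ sumFin c * sumFin b
sumFin-cauchySchwarz {zero}  a c b a²≤cb = z≤n
sumFin-cauchySchwarz {suc n} a c b a²≤cb =
  square≤product-+ {A = a F.zero} {C = c F.zero} {B = b F.zero} (a²≤cb F.zero)
    (sumFin-cauchySchwarz (λ i → a (F.suc i)) (λ i → c (F.suc i)) (λ i → b (F.suc i))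
      (λ i → a²≤cb (F.suc i)))

guard : Bool → ℕ → ℕ
guard b x = if b then x else 0

guard-+ : ∀ b x y → guard b (x + y) ≡ guard b x + guard b y
guard-+ false x y = refl
guard-+ true  x y = refl

guard-*ʳ : ∀ b x y → guard b (x * y) ≡ guard b x * y
guard-*ʳ false x y = refl
guard-*ʳ true  x y = refl

guard-cong : ∀ b {x y} → (b ≡ true → x ≡ y) → guard b x ≡ guard b y
guard-cong false x≡y = refl
guard-cong true  x≡y = x≡y refl

sumFin₂ : ∀ {m n} → (Fin m → Fin n → ℕ) → ℕ
sumFin₂ f = sumFin (λ i → sumFin (f i))

sumFin₂-cong : ∀ {m n} {f g : Fin m → Fin n → ℕ} → (∀ i j → f i j ≡ g i j) →
               sumFin₂ f ≡ sumFin₂ g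
sumFin₂-cong f≗g = sumFin-cong (λ i → sumFin-cong (f≗g i))

sumFin₂-distrib-+ : ∀ {m n} (f g : Fin m → Fin n → ℕ) →
                    sumFin₂ (λ i j → f i j + g i j) ≡ sumFin₂ f + sumFin₂ g
sumFin₂-distrib-+ f g =
  trans (sumFin-cong (λ i → sumFin-distrib-+ (f i) (g i)))
        (sumFin-distrib-+ (λ i → sumFin (f i)) (λ i → sumFin (g i)))

*-distribˡ-sumFin₂ : ∀ {m n} k (f : Fin m → Fin n → ℕ) →
                     k * sumFin₂ f ≡ sumFin₂ (λ i j → k * f i j)
*-distribˡ-sumFin₂ k f =
  trans (*-distribˡ-sumFin k (λ i → sumFin (f i))) (sumFin-cong (λ i → *-distribˡ-sumFin k (f i)))

sumFin₂-comm : ∀ {m n} (f : Fin m → Fin n → ℕ) → sumFin₂ f ≡ sumFin₂ (λ j i → f i j)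
sumFin₂-comm f = begin
  sumFin₂ f                              ≡⟨ sumFin₂≡sum² f ⟩
  sum (λ i → sum (f i))                  ≡⟨ ∑-comm f ⟩
  sum (λ j → sum (λ i → f i j))          ≡⟨ sumFin₂≡sum² (λ j i → f i j) ⟨
  sumFin₂ (λ j i → f i j)                ∎
  where
  open ≡-Reasoning
  sumFin₂≡sum² : ∀ {m n} (f : Fin m → Fin n → ℕ) → sumFin₂ f ≡ sum (λ i → sum (f i))
  sumFin₂≡sum² f = trans (sumFin≡sum (λ i → sumFin (f i))) (sum-cong-≗ (λ i → sumFin≡sum (f i)))

sumFin₂-cauchySchwarz : ∀ {m n} (w f : Fin m → Fin n → ℕ) →
  let wf = sumFin₂ (λ i j → w i j * f i j) in
  wf * wf ≤ sumFin₂ w * sumFin₂ (λ i j → w i j * (f i j * f i j))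
sumFin₂-cauchySchwarz w f =
  sumFin-cauchySchwarz _ _ _ (λ i →
    sumFin-cauchySchwarz _ _ _ (λ j → ≤-reflexive (regroup (w i j) (f i j))))
  where
  regroup : ∀ w f → (w * f) * (w * f) ≡ w * (w * (f * f))
  regroup = solve-∀

_<ᵇ_ : ∀ {n} → Fin n → Fin n → Bool
i <ᵇ j = ⌊ toℕ i <? toℕ j ⌋

sumFin₂-symmetrize : ∀ {n} (h : Fin n → Fin n → ℕ) → (∀ i → h i i ≡ 0) →
  sumFin₂ h ≡ sumFin₂ (λ i j → guard (i <ᵇ j) (h i j + h j i))
sumFin₂-symmetrize {n} h hᵢᵢ≡0 = begin
  sumFin₂ h
    ≡⟨ sumFin₂-cong split ⟩
  sumFin₂ (λ i j → below i j + above i j)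
    ≡⟨ sumFin₂-distrib-+ below above ⟩
  sumFin₂ below + sumFin₂ above
    ≡⟨ cong (sumFin₂ below +_) (sumFin₂-comm above) ⟩
  sumFin₂ below + sumFin₂ (λ i j → above j i)
    ≡⟨ sumFin₂-distrib-+ below (λ i j → above j i) ⟨
  sumFin₂ (λ i j → below i j + above j i)
    ≡⟨ sumFin₂-cong (λ i j → guard-+ (i <ᵇ j) (h i j) (h j i)) ⟨
  sumFin₂ (λ i j → guard (i <ᵇ j) (h i j + h j i))
    ∎
  where
  open ≡-Reasoning
  below above : Fin n → Fin n → ℕ
  below i j = guard (i <ᵇ j) (h i j)
  above i j = guard (j <ᵇ i) (h i j)
  split : ∀ i j → h i j ≡ below i j + above i j
  split i j with toℕ i <? toℕ j | toℕ j <? toℕ i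
  ... | yes i<j | yes j<i = ⊥-elim (<-asym i<j j<i)
  ... | yes _   | no  _   = sym (+-identityʳ _)
  ... | no  _   | yes _   = refl
  ... | no  i≮j | no  j≮i with toℕ-injective (≤-antisym (≮⇒≥ j≮i) (≮⇒≥ i≮j))
  ...   | refl = hᵢᵢ≡0 i

sumOfSquares : ℕ → ℕ → ℕ
sumOfSquares a b = a ^ 2 + b ^ 2

module _ {n : ℕ} (G : Graph n) where

  adjacency : Fin n → Fin n → ℕ
  adjacency i j = guard (adj G i j) 1

  edgeIndicator : Fin n → Fin n → ℕ
  edgeIndicator i j = guard (i <ᵇ j) (adjacency i j)

  edgeSum-weighted : (f : Fin n → Fin n → ℕ) →
                     edgeSum G f ≡ sumFin₂ (λ i j → edgeIndicator i j * f i j)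
  edgeSum-weighted f = sumFin₂-cong (λ i j → weight (i <ᵇ j) (adj G i j) (f i j))
    where
    weight : ∀ b c x → guard b (guard c x) ≡ guard b (guard c 1) * x
    weight false c     x = refl
    weight true  false x = refl
    weight true  true  x = sym (+-identityʳ x)

  edgeCount-weighted : edgeCount G ≡ sumFin₂ edgeIndicator
  edgeCount-weighted =
    trans (edgeSum-weighted (λ _ _ → 1)) (sumFin₂-cong (λ i j → *-identityʳ (edgeIndicator i j)))

  edgeSum-cong : {f g : Fin n → Fin n → ℕ} → (∀ i j → adj G i j ≡ true → f i j ≡ g i j) →
                 edgeSum G f ≡ edgeSum G g
  edgeSum-cong f≗g =
    sumFin₂-cong (λ i j → guard-cong (i <ᵇ j) (λ _ → guard-cong (adj G i j) (f≗g i j)))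

  edgeSum-distrib-+ : (f g : Fin n → Fin n → ℕ) →
                      edgeSum G (λ i j → f i j + g i j) ≡ edgeSum G f + edgeSum G g
  edgeSum-distrib-+ f g = begin
    edgeSum G (λ i j → f i j + g i j)
      ≡⟨ edgeSum-weighted _ ⟩
    sumFin₂ (λ i j → edgeIndicator i j * (f i j + g i j))
      ≡⟨ sumFin₂-cong (λ i j → *-distribˡ-+ (edgeIndicator i j) (f i j) (g i j)) ⟩
    sumFin₂ (λ i j → edgeIndicator i j * f i j + edgeIndicator i j * g i j)
      ≡⟨ sumFin₂-distrib-+ (λ i j → edgeIndicator i j * f i j) (λ i j → edgeIndicator i j * g i j) ⟩
    sumFin₂ (λ i j → edgeIndicator i j * f i j) + sumFin₂ (λ i j → edgeIndicator i j * g i j)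
      ≡⟨ cong₂ _+_ (edgeSum-weighted f) (edgeSum-weighted g) ⟨
    edgeSum G f + edgeSum G g
      ∎
    where open ≡-Reasoning

  *-distribˡ-edgeSum : (k : ℕ) (f : Fin n → Fin n → ℕ) →
                       k * edgeSum G f ≡ edgeSum G (λ i j → k * f i j)
  *-distribˡ-edgeSum k f = begin
    k * edgeSum G f
      ≡⟨ cong (k *_) (edgeSum-weighted f) ⟩
    k * sumFin₂ (λ i j → edgeIndicator i j * f i j)
      ≡⟨ *-distribˡ-sumFin₂ k (λ i j → edgeIndicator i j * f i j) ⟩
    sumFin₂ (λ i j → k * (edgeIndicator i j * f i j))
      ≡⟨ sumFin₂-cong (λ i j → x∙yz≈y∙xz k (edgeIndicator i j) (f i j)) ⟩
    sumFin₂ (λ i j → edgeIndicator i j * (k * f i j))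
      ≡⟨ edgeSum-weighted _ ⟨
    edgeSum G (λ i j → k * f i j)
      ∎
    where open ≡-Reasoning

  edgeSum-constant : {f : Fin n → Fin n → ℕ} (k : ℕ) → (∀ i j → adj G i j ≡ true → f i j ≡ k) →
                     edgeSum G f ≡ k * edgeCount G
  edgeSum-constant {f} k f≡k = begin
    edgeSum G f                  ≡⟨ edgeSum-cong (λ i j e → trans (f≡k i j e) (sym (*-identityʳ k))) ⟩
    edgeSum G (λ _ _ → k * 1)    ≡⟨ *-distribˡ-edgeSum k (λ _ _ → 1) ⟨
    k * edgeCount G              ∎
    where open ≡-Reasoning

  edgeSum-cauchySchwarz : (s : Fin n → Fin n → ℕ) →
    edgeSum G s * edgeSum G s ≤ edgeCount G * edgeSum G (λ i j → s i j * s i j)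
  edgeSum-cauchySchwarz s
    rewrite edgeSum-weighted s | edgeCount-weighted | edgeSum-weighted (λ i j → s i j * s i j)
    = sumFin₂-cauchySchwarz edgeIndicator s

  handshake : (x : Fin n → ℕ) → sumFin (λ i → deg G i * x i) ≡ edgeSum G (λ i j → x i + x j)
  handshake x = begin
    sumFin (λ i → deg G i * x i)
      ≡⟨ sumFin-cong (λ i → *-distribʳ-sumFin (x i) (adjacency i)) ⟩
    sumFin₂ (λ i j → adjacency i j * x i)
      ≡⟨ sumFin₂-symmetrize (λ i j → adjacency i j * x i) noLoops ⟩
    sumFin₂ (λ i j → guard (i <ᵇ j) (adjacency i j * x i + adjacency j i * x j))
      ≡⟨ sumFin₂-cong endpoints ⟩
    sumFin₂ (λ i j → edgeIndicator i j * (x i + x j))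
      ≡⟨ edgeSum-weighted _ ⟨
    edgeSum G (λ i j → x i + x j)
      ∎
    where
    open ≡-Reasoning
    noLoops : ∀ i → adjacency i i * x i ≡ 0
    noLoops i = cong (λ b → guard b 1 * x i) (adj-irrfl G i)
    endpoints : ∀ i j → guard (i <ᵇ j) (adjacency i j * x i + adjacency j i * x j)
                      ≡ edgeIndicator i j * (x i + x j)
    endpoints i j = begin
      guard (i <ᵇ j) (adjacency i j * x i + adjacency j i * x j)
        ≡⟨ cong (λ a → guard (i <ᵇ j) (adjacency i j * x i + guard a 1 * x j)) (adj-sym G j i) ⟩
      guard (i <ᵇ j) (adjacency i j * x i + adjacency i j * x j)
        ≡⟨ cong (guard (i <ᵇ j)) (*-distribˡ-+ (adjacency i j) (x i) (x j)) ⟨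
      guard (i <ᵇ j) (adjacency i j * (x i + x j))
        ≡⟨ guard-*ʳ (i <ᵇ j) (adjacency i j) (x i + x j) ⟩
      edgeIndicator i j * (x i + x j)
        ∎

  ConstantOnEdges : (Fin n → Fin n → ℕ) → Set
  ConstantOnEdges f = ∃[ k ] (∀ i j → adj G i j ≡ true → f i j ≡ k)

  edgeSum-cauchySchwarz-equality : {s : Fin n → Fin n → ℕ} → ConstantOnEdges s →
    edgeSum G s * edgeSum G s ≡ edgeCount G * edgeSum G (λ i j → s i j * s i j)
  edgeSum-cauchySchwarz-equality (k , s≡k)
    rewrite edgeSum-constant k s≡k
          | edgeSum-constant (k * k) (λ i j e → cong₂ _*_ (s≡k i j e) (s≡k i j e))
    = regroup k (edgeCount G)
    where
    regroup : ∀ k m → (k * m) * (k * m) ≡ m * ((k * k) * m)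
    regroup = solve-∀

  regular⇒constantOnEdges : Regular G → (g : ℕ → ℕ → ℕ) →
                            ConstantOnEdges (λ i j → g (deg G i) (deg G j))
  regular⇒constantOnEdges (k , deg≡k) g = g k k , λ i j _ → cong₂ g (deg≡k i) (deg≡k j)

  semiregular⇒constantOnEdges : Semiregular G → (g : ℕ → ℕ → ℕ) → (∀ a b → g a b ≡ g b a) →
                                ConstantOnEdges (λ i j → g (deg G i) (deg G j))
  semiregular⇒constantOnEdges (_ , colour , a , b , _ , proper , deg≡a , deg≡b , _) g g-sym =
    g a b , endpoints
    where
    endpoints : ∀ i j → adj G i j ≡ true → g (deg G i) (deg G j) ≡ g a b
    endpoints i j ij∈E with colour i in ci | colour j in cj
    ... | true  | true  = ⊥-elim (proper i j ij∈E (trans ci (sym cj)))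
    ... | false | false = ⊥-elim (proper i j ij∈E (trans ci (sym cj)))
    ... | true  | false = cong₂ g (deg≡a i ci) (deg≡b j cj)
    ... | false | true  = trans (cong₂ g (deg≡b i ci) (deg≡a j cj)) (g-sym b a)

  degreeSquareSum : Fin n → Fin n → ℕ
  degreeSquareSum i j = sumOfSquares (deg G i) (deg G j)

  regular⊎semiregular⇒constantOnEdges : Regular G ⊎ Semiregular G → ConstantOnEdges degreeSquareSum
  regular⊎semiregular⇒constantOnEdges (inj₁ regular) =
    regular⇒constantOnEdges regular sumOfSquares
  regular⊎semiregular⇒constantOnEdges (inj₂ semiregular) =
    semiregular⇒constantOnEdges semiregular sumOfSquares (λ a b → +-comm (a ^ 2) (b ^ 2))

  forgotten²≡edgeSum² : forgotten G ^ 2 ≡ edgeSum G degreeSquareSum * edgeSum G degreeSquareSum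
  forgotten²≡edgeSum² = begin
    forgotten G ^ 2                                        ≡⟨ cong (forgotten G *_) (^-identityʳ _) ⟩
    forgotten G * forgotten G                              ≡⟨ cong₂ _*_ F≡ F≡ ⟩
    edgeSum G degreeSquareSum * edgeSum G degreeSquareSum  ∎
    where
    open ≡-Reasoning
    F≡ : forgotten G ≡ edgeSum G degreeSquareSum
    F≡ = handshake (λ i → deg G i ^ 2)

  deg⁵-sum≡edgeSum-degreeSquareSum² :
    sumFin (λ i → deg G i ^ 5) + 2 * edgeSum G (λ i j → deg G i ^ 2 * deg G j ^ 2)
      ≡ edgeSum G (λ i j → degreeSquareSum i j * degreeSquareSum i j)
  deg⁵-sum≡edgeSum-degreeSquareSum² = begin
    sumFin (λ i → deg G i ^ 5) + 2 * edgeSum G (λ i j → deg G i ^ 2 * deg G j ^ 2)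
      ≡⟨ cong₂ _+_ (handshake (λ i → deg G i ^ 4)) (*-distribˡ-edgeSum 2 _) ⟩
    edgeSum G (λ i j → deg G i ^ 4 + deg G j ^ 4) + edgeSum G (λ i j → 2 * (deg G i ^ 2 * deg G j ^ 2))
      ≡⟨ edgeSum-distrib-+ _ _ ⟨
    edgeSum G (λ i j → deg G i ^ 4 + deg G j ^ 4 + 2 * (deg G i ^ 2 * deg G j ^ 2))
      ≡⟨ edgeSum-cong (λ i j _ → square-expand (deg G i) (deg G j)) ⟩
    edgeSum G (λ i j → degreeSquareSum i j * degreeSquareSum i j)
      ∎
    where
    open ≡-Reasoning
    open +-*-Solver
    square-expand : ∀ a b → a ^ 4 + b ^ 4 + 2 * (a ^ 2 * b ^ 2) ≡ (a ^ 2 + b ^ 2) * (a ^ 2 + b ^ 2)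
    square-expand = solve 2 (λ a b → a :^ 4 :+ b :^ 4 :+ con 2 :* (a :^ 2 :* b :^ 2)
                                  := (a :^ 2 :+ b :^ 2) :* (a :^ 2 :+ b :^ 2)) refl

proposition4 : (n : ℕ) → 3 ≤ n → (G : Graph n) → Connected G →
    (forgotten G ^ 2
       ≤ edgeCount G * (sumFin (λ i → deg G i ^ 5)
                        + 2 * edgeSum G (λ i j → deg G i ^ 2 * deg G j ^ 2)))
    × (Regular G ⊎ Semiregular G →
       forgotten G ^ 2
         ≡ edgeCount G * (sumFin (λ i → deg G i ^ 5)
                          + 2 * edgeSum G (λ i j → deg G i ^ 2 * deg G j ^ 2)))
proposition4 n _ G _
  rewrite forgotten²≡edgeSum² G | deg⁵-sum≡edgeSum-degreeSquareSum² G
  = edgeSum-cauchySchwarz G (degreeSquareSum G)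
  , λ reg⊎semireg → edgeSum-cauchySchwarz-equality G (regular⊎semiregular⇒constantOnEdges G reg⊎semireg)
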